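{- Let $L < N \le 2L$ be positive integers, let $\boldsymbol\xi_1, \dots, \boldsymbol\xi_L \in F_N$, let $\Xi = (\boldsymbol\xi_1\ \cdots\ \boldsymbol\xi_L)$ be the $N\times L$ matrix with these columns, and let $Y = \Xi^T = (\boldsymbol y_1\ \cdots\ \boldsymbol y_N) = (y_{\ell n})$ be the $L \times N$ transpose with columns $\boldsymbol y_n \in \mathbb{Z}^L$. Assume $\boldsymbol y_n \ne \boldsymbol 0$ for every $n$. For $\ell = 1,\dots,L$ let $S(\ell) = \{n : 1 \le n \le N,\ |y_{\ell n}| = 1\}$; for $A \subseteq \{1,\dots,N\}$ let $\eta(A) = \bigcup_{\ell:\, S(\ell)\cap A\ne\emptyset} S(\ell)$, and let $\mathcal P = \{A : \eta(A) = A\}$. Then for every nonempty $A \subseteq \{1,\dots,N\}$, $A \in \mathcal P$ if and only if $\sum_{n \in A} \boldsymbol y_n = \boldsymbol 0$.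
   Context: $F_N = \{\boldsymbol e_m - \boldsymbol e_n : 1\le m,n\le N,\ m\ne n\}$ where $\boldsymbol e_m$ are the standard basis vectors of $\mathbb{R}^N$. -}

module Defs where

open import Data.Nat using (ℕ; zero; suc)
open import Data.Integer using (ℤ; 0ℤ; 1ℤ; _+_; _-_; ∣_∣)
open import Data.Fin using (Fin; zero; suc; _≟_)
open import Data.Fin.Subset using (Subset; _∈_; Nonempty)
open import Data.Product using (Σ; ∃; ∃-syntax; _×_)
open import Relation.Binary.PropositionalEquality using (_≡_; _≢_)
open import Relation.Nullary using (¬_; yes; no)
open import Function.Bundles using (_⇔_)
open import Data.Fin.Subset.Properties using (_∈?_)

e : ∀ {N} → Fin N → Fin N → ℤ
e m k with k ≟ m
... | yes _ = 1ℤ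
... | no _  = 0ℤ

InF : ∀ N → (Fin N → ℤ) → Set
InF N v = ∃[ m ] ∃[ n ] (m ≢ n × (∀ k → v k ≡ e m k - e n k))

sumFin : ∀ {N} → (Fin N → ℤ) → ℤ
sumFin {zero} f = 0ℤ
sumFin {suc N} f = f zero + sumFin (λ k → f (suc k))

-- ξ ℓ n = ℓ-th column ξ_ℓ evaluated at coordinate n, i.e. Ξ_{nℓ} = y_{ℓn}.
-- Column y_n of Y = Ξ^T is (λ ℓ → ξ ℓ n).

InS : ∀ {L N} → (Fin L → Fin N → ℤ) → Fin L → Fin N → Set
InS ξ ℓ n = ∣ ξ ℓ n ∣ ≡ 1

InEta : ∀ {L N} → (Fin L → Fin N → ℤ) → Subset N → Fin N → Set
InEta ξ A n = ∃[ ℓ ] ((∃[ m ] (m ∈ A × InS ξ ℓ m)) × InS ξ ℓ n)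

InP : ∀ {L N} → (Fin L → Fin N → ℤ) → Subset N → Set
InP ξ A = ∀ n → (InEta ξ A n ⇔ n ∈ A)

restrict : ∀ {N} → Subset N → (Fin N → ℤ) → Fin N → ℤ
restrict A f n with n ∈? A
... | yes _ = f n
... | no _  = 0ℤ

SumZero : ∀ {L N} → (Fin L → Fin N → ℤ) → Subset N → Set
SumZero ξ A = ∀ ℓ → sumFin (restrict A (ξ ℓ)) ≡ 0ℤ

{-# OPTIONS --safe #-}
-- Each column ξ_ℓ = e_a − e_b is an edge {a, b}: S(ℓ) = {a, b}, and the ℓ-th
-- coordinate of Σ_{n ∈ A} y_n is [a ∈ A] − [b ∈ A]. So the sum vanishes iff
-- every edge has both or neither endpoint in A. The same condition says that
-- η(A) ⊆ A, while A ⊆ η(A) holds because y_n ≠ 0 puts every n on some edge.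
module Submission where

open import Defs
open import Data.Nat using (ℕ; zero; suc; _<_; _≤_; _*_)
open import Data.Integer using (ℤ; 0ℤ; 1ℤ; _+_; _-_; ∣_∣)
open import Data.Integer.Properties using (+-identityˡ; +-identityʳ) renaming (_≟_ to _≟ℤ_)
open import Data.Integer.Tactic.RingSolver using (solve-∀)
open import Data.Fin using (Fin; zero; suc; _≟_)
open import Data.Fin.Properties using (suc-injective; ¬∀⟶∃¬)
open import Data.Fin.Subset using (Subset; Nonempty; _∈_)
open import Data.Fin.Subset.Properties using (_∈?_)
open import Data.Product using (_,_; proj₁; proj₂)
open import Data.Sum using (_⊎_; inj₁; inj₂)
open import Function using (_∘_; const)
open import Function.Bundles using (_⇔_; mk⇔; Equivalence)
import Function.Properties.Equivalence as ⇔
open import Relation.Binary.PropositionalEquality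
open import Relation.Nullary using (¬_; Dec; yes; no)
open import Relation.Nullary.Negation using (contradiction)

open Equivalence using (to; from)

sumFin-cong : ∀ {N} {f g : Fin N → ℤ} → (∀ k → f k ≡ g k) → sumFin f ≡ sumFin g
sumFin-cong {zero}  f≗g = refl
sumFin-cong {suc N} f≗g = cong₂ _+_ (f≗g zero) (sumFin-cong (f≗g ∘ suc))

sumFin-zero : ∀ {N} {f : Fin N → ℤ} → (∀ k → f k ≡ 0ℤ) → sumFin f ≡ 0ℤ
sumFin-zero {zero}  f≗0 = refl
sumFin-zero {suc N} f≗0 = cong₂ _+_ (f≗0 zero) (sumFin-zero (f≗0 ∘ suc))

sumFin-sub : ∀ {N} (f g : Fin N → ℤ) →
             sumFin (λ k → f k - g k) ≡ sumFin f - sumFin g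
sumFin-sub {zero}  f g = refl
sumFin-sub {suc N} f g =
  trans (cong (f zero - g zero +_) (sumFin-sub (f ∘ suc) (g ∘ suc)))
        (interchange (f zero) (g zero) (sumFin (f ∘ suc)) (sumFin (g ∘ suc)))
  where
  interchange : ∀ a b c d → (a - b) + (c - d) ≡ (a + c) - (b + d)
  interchange = solve-∀

sumFin-single : ∀ {N} (f : Fin N → ℤ) m → (∀ k → k ≢ m → f k ≡ 0ℤ) → sumFin f ≡ f m
sumFin-single {suc N} f zero f≗0 =
  trans (cong (f zero +_) (sumFin-zero (λ k → f≗0 (suc k) λ ())))
        (+-identityʳ (f zero))
sumFin-single {suc N} f (suc m) f≗0 =
  trans (cong₂ _+_ (f≗0 zero λ ()) (sumFin-single (f ∘ suc) m
                                     (λ k k≢m → f≗0 (suc k) (k≢m ∘ suc-injective))))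
        (+-identityˡ (f (suc m)))

e-diagonal : ∀ {N} (m : Fin N) → e m m ≡ 1ℤ
e-diagonal m with m ≟ m
... | yes _   = refl
... | no m≢m = contradiction refl m≢m

e-offDiagonal : ∀ {N} {m k : Fin N} → k ≢ m → e m k ≡ 0ℤ
e-offDiagonal {m = m} {k} k≢m with k ≟ m
... | yes k≡m = contradiction k≡m k≢m
... | no _    = refl

𝟙 : ∀ {N} → Subset N → Fin N → ℤ
𝟙 A = restrict A (const 1ℤ)

module _ {N} (A : Subset N) where

  restrict-congAt : ∀ {f g : Fin N → ℤ} k → f k ≡ g k → restrict A f k ≡ restrict A g k
  restrict-congAt k fk≡gk with k ∈? A
  ... | yes _ = fk≡gk
  ... | no _  = refl

  restrict-sub : ∀ (f g : Fin N → ℤ) k →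
                 restrict A (λ j → f j - g j) k ≡ restrict A f k - restrict A g k
  restrict-sub f g k with k ∈? A
  ... | yes _ = refl
  ... | no _  = refl

  restrict-zero : ∀ {f : Fin N → ℤ} k → f k ≡ 0ℤ → restrict A f k ≡ 0ℤ
  restrict-zero k fk≡0 with k ∈? A
  ... | yes _ = fk≡0
  ... | no _  = refl

  sumFin-restrict-e : ∀ m → sumFin (restrict A (e m)) ≡ 𝟙 A m
  sumFin-restrict-e m =
    trans (sumFin-single _ m (λ k k≢m → restrict-zero k (e-offDiagonal k≢m)))
          (restrict-congAt m (e-diagonal m))

  sumFin-restrict-edge : ∀ {a b} {v : Fin N → ℤ} → (∀ k → v k ≡ e a k - e b k) →
                         sumFin (restrict A v) ≡ 𝟙 A a - 𝟙 A b
  sumFin-restrict-edge {a} {b} {v} v≗ = begin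
    sumFin (restrict A v)
      ≡⟨ sumFin-cong (λ k → trans (restrict-congAt k (v≗ k)) (restrict-sub (e a) (e b) k)) ⟩
    sumFin (λ k → restrict A (e a) k - restrict A (e b) k)
      ≡⟨ sumFin-sub (restrict A (e a)) (restrict A (e b)) ⟩
    sumFin (restrict A (e a)) - sumFin (restrict A (e b))
      ≡⟨ cong₂ _-_ (sumFin-restrict-e a) (sumFin-restrict-e b) ⟩
    𝟙 A a - 𝟙 A b ∎
    where open ≡-Reasoning

  𝟙-sub≡0⇔ : ∀ a b → (𝟙 A a - 𝟙 A b ≡ 0ℤ) ⇔ (a ∈ A ⇔ b ∈ A)
  𝟙-sub≡0⇔ a b with a ∈? A | b ∈? A
  ... | yes a∈A | yes b∈A = mk⇔ (λ _ → mk⇔ (const b∈A) (const a∈A)) (const refl)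
  ... | no a∉A  | no b∉A  =
    mk⇔ (λ _ → mk⇔ (λ a∈A → contradiction a∈A a∉A) (λ b∈A → contradiction b∈A b∉A)) (const refl)
  ... | yes a∈A | no b∉A  = mk⇔ (λ ()) (λ a⇔b → contradiction (to a⇔b a∈A) b∉A)
  ... | no a∉A  | yes b∈A = mk⇔ (λ ()) (λ a⇔b → contradiction (from a⇔b b∈A) a∉A)

module _ {N} {a b : Fin N} where

  edge-offEndpoints : ∀ {k} → k ≢ a → k ≢ b → e a k - e b k ≡ 0ℤ
  edge-offEndpoints k≢a k≢b rewrite e-offDiagonal k≢a | e-offDiagonal k≢b = refl

  edge≢0⇒endpoint : ∀ k → e a k - e b k ≢ 0ℤ → k ≡ a ⊎ k ≡ b
  edge≢0⇒endpoint k edge≢0 = endpoint (k ≟ a) (k ≟ b)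
    where
    endpoint : Dec (k ≡ a) → Dec (k ≡ b) → k ≡ a ⊎ k ≡ b
    endpoint (yes k≡a) _         = inj₁ k≡a
    endpoint (no _)    (yes k≡b) = inj₂ k≡b
    endpoint (no k≢a)  (no k≢b)  = contradiction (edge-offEndpoints k≢a k≢b) edge≢0

  ∣edge∣-head : a ≢ b → ∣ e a a - e b a ∣ ≡ 1
  ∣edge∣-head a≢b rewrite e-diagonal a | e-offDiagonal a≢b = refl

  ∣edge∣-tail : a ≢ b → ∣ e a b - e b b ∣ ≡ 1
  ∣edge∣-tail a≢b rewrite e-diagonal b | e-offDiagonal (a≢b ∘ sym) = refl

⇔-endpoints-closed : ∀ {I : Set} {P : I → Set} {a b m n} → (P a ⇔ P b) →
                     m ≡ a ⊎ m ≡ b → n ≡ a ⊎ n ≡ b → P m → P n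
⇔-endpoints-closed Pa⇔Pb (inj₁ refl) (inj₁ refl) = λ p → p
⇔-endpoints-closed Pa⇔Pb (inj₁ refl) (inj₂ refl) = to Pa⇔Pb
⇔-endpoints-closed Pa⇔Pb (inj₂ refl) (inj₁ refl) = from Pa⇔Pb
⇔-endpoints-closed Pa⇔Pb (inj₂ refl) (inj₂ refl) = λ p → p

module Edges {L N} (ξ : Fin L → Fin N → ℤ) (ξ∈F : ∀ ℓ → InF N (ξ ℓ)) where

  head tail : Fin L → Fin N
  head ℓ = proj₁ (ξ∈F ℓ)
  tail ℓ = proj₁ (proj₂ (ξ∈F ℓ))

  head≢tail : ∀ ℓ → head ℓ ≢ tail ℓ
  head≢tail ℓ = proj₁ (proj₂ (proj₂ (ξ∈F ℓ)))

  ξ≗edge : ∀ ℓ k → ξ ℓ k ≡ e (head ℓ) k - e (tail ℓ) k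
  ξ≗edge ℓ = proj₂ (proj₂ (proj₂ (ξ∈F ℓ)))

  Balanced : Subset N → Set
  Balanced A = ∀ ℓ → (head ℓ ∈ A ⇔ tail ℓ ∈ A)

  head∈S : ∀ ℓ → InS ξ ℓ (head ℓ)
  head∈S ℓ rewrite ξ≗edge ℓ (head ℓ) = ∣edge∣-head (head≢tail ℓ)

  tail∈S : ∀ ℓ → InS ξ ℓ (tail ℓ)
  tail∈S ℓ rewrite ξ≗edge ℓ (tail ℓ) = ∣edge∣-tail (head≢tail ℓ)

  nonzero⇒endpoint : ∀ ℓ k → ξ ℓ k ≢ 0ℤ → k ≡ head ℓ ⊎ k ≡ tail ℓ
  nonzero⇒endpoint ℓ k ξℓk≢0 = edge≢0⇒endpoint k (ξℓk≢0 ∘ trans (ξ≗edge ℓ k))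

  S⇒endpoint : ∀ ℓ k → InS ξ ℓ k → k ≡ head ℓ ⊎ k ≡ tail ℓ
  S⇒endpoint ℓ k k∈S = nonzero⇒endpoint ℓ k λ ξℓk≡0 → 0≢1 (trans (sym (cong ∣_∣ ξℓk≡0)) k∈S)
    where
    0≢1 : ¬ (0 ≡ 1)
    0≢1 ()

  SumZero⇔Balanced : ∀ A → SumZero ξ A ⇔ Balanced A
  SumZero⇔Balanced A = mk⇔
    (λ sum≡0 ℓ → to (𝟙-sub≡0⇔ A (head ℓ) (tail ℓ)) (trans (sym (edgeSum ℓ)) (sum≡0 ℓ)))
    (λ balanced ℓ → trans (edgeSum ℓ) (from (𝟙-sub≡0⇔ A (head ℓ) (tail ℓ)) (balanced ℓ)))
    where
    edgeSum : ∀ ℓ → sumFin (restrict A (ξ ℓ)) ≡ 𝟙 A (head ℓ) - 𝟙 A (tail ℓ)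
    edgeSum ℓ = sumFin-restrict-edge A (ξ≗edge ℓ)

  η⊆⇒Balanced : ∀ {A} → (∀ n → InEta ξ A n → n ∈ A) → Balanced A
  η⊆⇒Balanced η⊆A ℓ = mk⇔
    (λ h∈A → η⊆A (tail ℓ) (ℓ , (head ℓ , h∈A , head∈S ℓ) , tail∈S ℓ))
    (λ t∈A → η⊆A (head ℓ) (ℓ , (tail ℓ , t∈A , tail∈S ℓ) , head∈S ℓ))

  Balanced⇒η⊆ : ∀ {A} → Balanced A → ∀ n → InEta ξ A n → n ∈ A
  Balanced⇒η⊆ balanced n (ℓ , (m , m∈A , m∈S) , n∈S) =
    ⇔-endpoints-closed (balanced ℓ) (S⇒endpoint ℓ m m∈S) (S⇒endpoint ℓ n n∈S) m∈A

  ⊆η : (∀ n → ¬ (∀ ℓ → ξ ℓ n ≡ 0ℤ)) → ∀ {A} n → n ∈ A → InEta ξ A n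
  ⊆η y≢0 n n∈A with ℓ , ξℓn≢0 ← ¬∀⟶∃¬ L (λ ℓ → ξ ℓ n ≡ 0ℤ) (λ ℓ → ξ ℓ n ≟ℤ 0ℤ) (y≢0 n)
    with nonzero⇒endpoint ℓ n ξℓn≢0
  ... | inj₁ refl = ℓ , (n , n∈A , head∈S ℓ) , head∈S ℓ
  ... | inj₂ refl = ℓ , (n , n∈A , tail∈S ℓ) , tail∈S ℓ

  InP⇔Balanced : (∀ n → ¬ (∀ ℓ → ξ ℓ n ≡ 0ℤ)) → ∀ A → InP ξ A ⇔ Balanced A
  InP⇔Balanced y≢0 A = mk⇔
    (λ η≡A → η⊆⇒Balanced (λ n → to (η≡A n)))
    (λ balanced n → mk⇔ (Balanced⇒η⊆ balanced n) (⊆η y≢0 n))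

lemma3p6 : (L N : ℕ) → 1 ≤ L → L < N → N ≤ 2 * L →
             (ξ : Fin L → Fin N → ℤ) →
             (∀ ℓ → InF N (ξ ℓ)) →
             (∀ n → ¬ (∀ ℓ → ξ ℓ n ≡ 0ℤ)) →
             (A : Subset N) → Nonempty A →
             (InP ξ A ⇔ SumZero ξ A)
lemma3p6 L N _ _ _ ξ ξ∈F y≢0 A _ =
  ⇔.trans (InP⇔Balanced y≢0 A) (⇔.sym (SumZero⇔Balanced A))
  where open Edges ξ ξ∈F
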